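{- $TAUT_{NM_\infty}\forall=\bigcap_{n\ge 2}TAUT_{NM_n}\forall$.
   Context: $NM_n$ ($n\ge2$) is the $n$-element NM-chain, realized as the subalgebra of $[0,1]_{\mathrm{NM}}$ with universe $\{0,\frac1{n-1},\dots,\frac{n-2}{n-1},1\}$; $NM_\infty$ is the subalgebra with universe $\{\frac1k:k\in\mathbb{N}^+\}\cup\{1-\frac1k:k\in\mathbb{N}^+\}$. In these chains the order is the real order, $n(x)=1-x$, $x*y=0$ if $x\le1-y$ and $\min(x,y)$ otherwise, $x\Rightarrow y=1$ if $x\le y$ and $\max(1-x,y)$ otherwise. First-order formulas over a fixed countable predicate language use $\&,\land,\to,\bot,\forall,\exists$, interpreted by $*,\min,\Rightarrow,0$, infimum, supremum. For a chain $\mathcal{A}$, an $\mathcal{A}$-model has a nonempty domain and maps $M^k\to A$ for $k$-ary predicates (and elements for constants); it is safe if all needed infima/suprema exist. $TAUT_{\mathcal{A}}\forall$ is the set of formulas taking value $1$ under every evaluation in every safe $\mathcal{A}$-model. -}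

module Defs where

open import Level using (Level) renaming (suc to lsuc; zero to lzero)
open import Data.Nat as ℕ using (ℕ; zero; suc; _∸_)
open import Data.Integer using (+_)
open import Data.Rational using (ℚ; 0ℚ; 1ℚ; _/_; _≤_; _≤ᵇ_; _⊓_; _⊔_; _-_; _*_)
open import Data.Bool using (if_then_else_)
open import Data.Vec using (Vec; map)
open import Data.Product using (Σ; _×_; _,_; ∃)
open import Data.Sum using (_⊎_)
open import Relation.Binary.PropositionalEquality using (_≡_)
open import Function.Definitions using (Injective)
open import Relation.Nullary using (yes; no)

-- A chain is given by its universe, a subset of ℚ (ordered by the real order).
Chain : Set₁
Chain = ℚ → Set

neg : ℚ → ℚ
neg x = 1ℚ - x

_⊛_ : ℚ → ℚ → ℚ
x ⊛ y = if x ≤ᵇ neg y then 0ℚ else (x ⊓ y)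

_⇛_ : ℚ → ℚ → ℚ
x ⇛ y = if x ≤ᵇ y then 1ℚ else (neg x ⊔ y)

-- NM_n : universe {0, 1/(n-1), ..., (n-2)/(n-1), 1}  (used only for n ≥ 2):
-- q ∈ NM_n  iff  q·(n-1) = i for some natural i ≤ n-1.
NM : ℕ → Chain
NM n q = Σ ℕ λ i → (i ℕ.≤ n ∸ 1) × (q * ((+ (n ∸ 1)) / 1) ≡ (+ i) / 1)

NM∞ : Chain
NM∞ q = Σ ℕ λ k → (q ≡ (+ 1) / suc k) ⊎ (q ≡ 1ℚ - (+ 1) / suc k)

record Language : Set₁ where
  field
    Pred   : Set
    arity  : Pred → ℕ
    Const  : Set
    encP   : Pred → ℕ
    encP-inj : Injective _≡_ _≡_ encP
    encC   : Const → ℕ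
    encC-inj : Injective _≡_ _≡_ encC

module _ (L : Language) where
  open Language L

  Var : Set
  Var = ℕ

  data Term : Set where
    var : Var → Term
    con : Const → Term

  data Formula : Set where
    atom : (P : Pred) → Vec Term (arity P) → Formula
    ⊥̇    : Formula
    _&̇_  : Formula → Formula → Formula
    _∧̇_  : Formula → Formula → Formula
    _→̇_  : Formula → Formula → Formula
    ∀̇    : Var → Formula → Formula
    ∃̇    : Var → Formula → Formula

  record Model (A : Chain) : Set₁ where
    field
      Dom      : Set
      inhabit  : Dom
      const    : Const → Dom
      pred     : (P : Pred) → Vec Dom (arity P) → ℚ
      pred∈A   : ∀ P ds → A (pred P ds)

  module _ {A : Chain} (M : Model A) where
    open Model M

    Eval : Set
    Eval = Var → Dom

    update : Eval → Var → Dom → Eval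
    update e x d y with x ℕ.≟ y
    ... | yes _ = d
    ... | no  _ = e y

    termVal : Eval → Term → Dom
    termVal e (var x) = e x
    termVal e (con c) = const c

    IsInf : (ℚ → Set) → ℚ → Set
    IsInf S v = A v × (∀ w → S w → v ≤ w)
              × (∀ u → A u → (∀ w → S w → u ≤ w) → u ≤ v)

    IsSup : (ℚ → Set) → ℚ → Set
    IsSup S v = A v × (∀ w → S w → w ≤ v)
              × (∀ u → A u → (∀ w → S w → w ≤ u) → v ≤ u)

    -- ‖φ‖_e = v  (as a relation, since infima/suprema need not exist)
    Val : Eval → Formula → ℚ → Set
    Val e (atom P ts) v = v ≡ pred P (map (termVal e) ts)
    Val e ⊥̇ v = v ≡ 0ℚ
    Val e (φ &̇ ψ) v = Σ ℚ λ a → Σ ℚ λ b → Val e φ a × Val e ψ b × (v ≡ a ⊛ b)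
    Val e (φ ∧̇ ψ) v = Σ ℚ λ a → Σ ℚ λ b → Val e φ a × Val e ψ b × (v ≡ a ⊓ b)
    Val e (φ →̇ ψ) v = Σ ℚ λ a → Σ ℚ λ b → Val e φ a × Val e ψ b × (v ≡ a ⇛ b)
    Val e (∀̇ x φ) v = IsInf (λ w → Σ Dom λ d → Val (update e x d) φ w) v
    Val e (∃̇ x φ) v = IsSup (λ w → Σ Dom λ d → Val (update e x d) φ w) v

    Safe : Set
    Safe = ∀ (e : Eval) (φ : Formula) → ∃ λ v → Val e φ v

  TAUT : Chain → Formula → Set₁
  TAUT A φ = ∀ (M : Model A) → Safe M → ∀ (e : Eval M) (v : ℚ) → Val M e φ v → v ≡ 1ℚ

-- Truth values of a safe A-model can be pushed along any map A → B that preserves the NM-operations and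
-- enough infima and suprema; a formula true in B is then sent to 1.  NM_(m+1) embeds into NM∞ as the even
-- rungs of a finite symmetric "ladder" 0 < 1/(m+1) < … < 1/2 < … < m/(m+1) < 1, so NM∞-tautologies hold in
-- every NM_n.  Conversely, for each N, collapsing NM∞ to NM_(2N+1) keeps everything below (N+1)/(N+2)
-- away from 1; a value in a safe NM∞-model that is sent to 1 by all these maps lies above every
-- (N+1)/(N+2), hence is 1.
module Submission where

open import Defs
open import Data.Nat as ℕ using (ℕ; zero; suc; _∸_; _+_; z≤n; s≤s) renaming (_≤_ to _≤ₙ_; _<_ to _<ₙ_)
import Data.Nat.Properties as ℕP
import Data.Nat.Tactic.RingSolver as ℕSolver
open import Data.Integer as ℤ using (+_)
import Data.Integer.Properties as ℤP
import Data.Integer.Tactic.RingSolver as ℤSolver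
open import Data.Rational as ℚ using (ℚ; 0ℚ; 1ℚ; _≤_; _<_; _/_; _-_; _*_; _⊓_; _⊔_; _≤ᵇ_; toℚᵘ)
import Data.Rational.Properties as ℚP
open import Data.Rational.Solver using (module +-*-Solver)
import Data.Rational.Unnormalised as U
import Data.Rational.Unnormalised.Properties as UP
open import Data.Bool using (true; false; T)
open import Data.Product using (Σ; _×_; _,_; proj₁; proj₂)
open import Data.Sum using (_⊎_; inj₁; inj₂)
open import Data.Empty using (⊥-elim)
open import Data.Vec.Properties using (map-cong)
open import Function using (_∘_)
open import Relation.Nullary using (¬_; yes; no)
open import Relation.Unary using (Decidable)
open import Relation.Binary using (tri<; tri≈; tri>)
open import Relation.Binary.PropositionalEquality

neg-involutive : ∀ x → neg (neg x) ≡ x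
neg-involutive = solve 1 (λ x → con 1ℚ :- (con 1ℚ :- x) := x) refl
  where open +-*-Solver

neg-antitone : ∀ {x y} → x ≤ y → neg y ≤ neg x
neg-antitone x≤y = ℚP.+-monoʳ-≤ 1ℚ (ℚP.neg-antimono-≤ x≤y)

≤ᵇ≡true⇒≤ : ∀ {x y} → (x ≤ᵇ y) ≡ true → x ≤ y
≤ᵇ≡true⇒≤ eq = ℚP.≤ᵇ⇒≤ (subst T (sym eq) _)

≤ᵇ≡false⇒> : ∀ {x y} → (x ≤ᵇ y) ≡ false → y < x
≤ᵇ≡false⇒> eq = ℚP.≰⇒> (λ x≤y → subst T eq (ℚP.≤⇒≤ᵇ x≤y))

≤⇒≤ᵇ≡true : ∀ {x y} → x ≤ y → (x ≤ᵇ y) ≡ true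
≤⇒≤ᵇ≡true {x} {y} x≤y with x ≤ᵇ y | ℚP.≤⇒≤ᵇ x≤y
... | true | _ = refl

Is0or1 : ℚ → Set
Is0or1 b = b ≡ 0ℚ ⊎ b ≡ 1ℚ

⊓-neg-0or1 : ∀ {b} → Is0or1 b → b ⊓ neg b ≡ 0ℚ
⊓-neg-0or1 (inj₁ refl) = refl
⊓-neg-0or1 (inj₂ refl) = refl

neg-⊔-0or1 : ∀ {b} → Is0or1 b → neg b ⊔ b ≡ 1ℚ
neg-⊔-0or1 (inj₁ refl) = refl
neg-⊔-0or1 (inj₂ refl) = refl

-- ⊛ and ⇛ are defined from the order and n, so a monotone map commuting with n preserves them except
-- where it identifies two elements; identifying elements is harmless only over 0 and 1.
-- The map is a relation so that it need not depend on proofs of membership in A.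
record NMReduction (A B : Chain) : Set₁ where
  infix 4 _↦_
  field
    _↦_        : ℚ → ℚ → Set
    ↦-dom      : ∀ {a b} → a ↦ b → A a
    ↦-cod      : ∀ {a b} → a ↦ b → B b
    image      : ∀ {a} → A a → Σ ℚ (a ↦_)
    ↦-mono     : ∀ {a b a' b'} → a ↦ b → a' ↦ b' → a ≤ a' → b ≤ b'
    ↦-neg      : ∀ {a b} → a ↦ b → neg a ↦ neg b
    0↦0        : 0ℚ ↦ 0ℚ
    fibre-0or1 : ∀ {a a' b} → a ↦ b → a' ↦ b → a < a' → Is0or1 b
    inf-lift   : ∀ {u} → B u → Σ ℚ λ c → A c
                   × (∀ {a b} → a ↦ b → u ≤ b → c ≤ a) × (∀ {b} → c ↦ b → u ≤ b)
    sup-lift   : ∀ {u} → B u → Σ ℚ λ c → A c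
                   × (∀ {a b} → a ↦ b → b ≤ u → a ≤ c) × (∀ {b} → c ↦ b → b ≤ u)

module NMReductionProperties {A B : Chain} (ρ : NMReduction A B) where
  open NMReduction ρ

  1↦1 : 1ℚ ↦ 1ℚ
  1↦1 = ↦-neg 0↦0

  ↦-⊓ : ∀ {a b a' b'} → a ↦ b → a' ↦ b' → (a ⊓ a') ↦ (b ⊓ b')
  ↦-⊓ {a} {b} {a'} {b'} r r' with ℚP.≤-total a a'
  ... | inj₁ a≤a' = subst₂ _↦_ (sym (ℚP.p≤q⇒p⊓q≡p a≤a')) (sym (ℚP.p≤q⇒p⊓q≡p (↦-mono r r' a≤a'))) r
  ... | inj₂ a'≤a = subst₂ _↦_ (sym (ℚP.p≥q⇒p⊓q≡q a'≤a)) (sym (ℚP.p≥q⇒p⊓q≡q (↦-mono r' r a'≤a))) r'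

  ↦-⊔ : ∀ {a b a' b'} → a ↦ b → a' ↦ b' → (a ⊔ a') ↦ (b ⊔ b')
  ↦-⊔ {a} {b} {a'} {b'} r r' with ℚP.≤-total a a'
  ... | inj₁ a≤a' = subst₂ _↦_ (sym (ℚP.p≤q⇒p⊔q≡q a≤a')) (sym (ℚP.p≤q⇒p⊔q≡q (↦-mono r r' a≤a'))) r'
  ... | inj₂ a'≤a = subst₂ _↦_ (sym (ℚP.p≥q⇒p⊔q≡p a'≤a)) (sym (ℚP.p≥q⇒p⊔q≡p (↦-mono r' r a'≤a))) r

  ↦-⊛ : ∀ {a b a' b'} → a ↦ b → a' ↦ b' → (a ⊛ a') ↦ (b ⊛ b')
  ↦-⊛ {a} {b} {a'} {b'} r r' with a ≤ᵇ neg a' in a≤na'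
  ... | true rewrite ≤⇒≤ᵇ≡true (↦-mono r (↦-neg r') (≤ᵇ≡true⇒≤ a≤na')) = 0↦0
  ... | false with b ≤ᵇ neg b' in b≤nb'
  ...   | false = ↦-⊓ r r'
  ...   | true = subst (a ⊓ a' ↦_) b⊓b'≡0 (↦-⊓ r r')
    where
    na'<a : neg a' < a
    na'<a = ≤ᵇ≡false⇒> a≤na'
    nb'≡b : neg b' ≡ b
    nb'≡b = ℚP.≤-antisym (↦-mono (↦-neg r') r (ℚP.<⇒≤ na'<a)) (≤ᵇ≡true⇒≤ b≤nb')
    b⊓b'≡0 : b ⊓ b' ≡ 0ℚ
    b⊓b'≡0 = begin
      b ⊓ b'             ≡⟨ cong (b ⊓_) (trans (sym (neg-involutive b')) (cong neg nb'≡b)) ⟩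
      b ⊓ neg b          ≡⟨ ⊓-neg-0or1 (fibre-0or1 (subst (neg a' ↦_) nb'≡b (↦-neg r')) r na'<a) ⟩
      0ℚ                 ∎
      where open ≡-Reasoning

  ↦-⇛ : ∀ {a b a' b'} → a ↦ b → a' ↦ b' → (a ⇛ a') ↦ (b ⇛ b')
  ↦-⇛ {a} {b} {a'} {b'} r r' with a ≤ᵇ a' in a≤a'
  ... | true rewrite ≤⇒≤ᵇ≡true (↦-mono r r' (≤ᵇ≡true⇒≤ a≤a')) = 1↦1
  ... | false with b ≤ᵇ b' in b≤b'
  ...   | false = ↦-⊔ (↦-neg r) r'
  ...   | true = subst (neg a ⊔ a' ↦_) (neg-⊔-0or1 b-0or1) (↦-⊔ (↦-neg r) r'')
    where
    a'<a : a' < a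
    a'<a = ≤ᵇ≡false⇒> a≤a'
    r'' : a' ↦ b
    r'' = subst (a' ↦_) (ℚP.≤-antisym (↦-mono r' r (ℚP.<⇒≤ a'<a)) (≤ᵇ≡true⇒≤ b≤b')) r'
    b-0or1 : Is0or1 b
    b-0or1 = fibre-0or1 r'' r a'<a

module _ (L : Language) where

  module _ {C : Chain} (N : Model L C) where
    open Model N

    VariantValue : Eval L N → Var L → Formula L → ℚ → Set
    VariantValue e x φ w = Σ Dom λ d → Val L N (update L N e x d) φ w

    update-cong : ∀ {e e'} → e ≗ e' → ∀ x d → update L N e x d ≗ update L N e' x d
    update-cong e≗e' x d y with x ℕ.≟ y
    ... | yes _ = refl
    ... | no _ = e≗e' y

    Val-cong : ∀ {e e'} → e ≗ e' → ∀ φ {v} → Val L N e φ v → Val L N e' φ v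
    Val-cong e≗e' (atom P ts) hv = trans hv (cong (pred P) (map-cong term-cong ts))
      where
      term-cong : ∀ t → termVal L N _ t ≡ termVal L N _ t
      term-cong (var x) = e≗e' x
      term-cong (con c) = refl
    Val-cong e≗e' ⊥̇ hv = hv
    Val-cong e≗e' (φ &̇ ψ) (a , b , ha , hb , ev) = a , b , Val-cong e≗e' φ ha , Val-cong e≗e' ψ hb , ev
    Val-cong e≗e' (φ ∧̇ ψ) (a , b , ha , hb , ev) = a , b , Val-cong e≗e' φ ha , Val-cong e≗e' ψ hb , ev
    Val-cong e≗e' (φ →̇ ψ) (a , b , ha , hb , ev) = a , b , Val-cong e≗e' φ ha , Val-cong e≗e' ψ hb , ev
    Val-cong e≗e' (∀̇ x φ) (cv , lower , greatest) =
      cv , (λ w (d , hw) → lower w (d , Val-cong (update-cong (sym ∘ e≗e') x d) φ hw))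
         , (λ u cu lower' → greatest u cu (λ w (d , hw) → lower' w (d , Val-cong (update-cong e≗e' x d) φ hw)))
    Val-cong e≗e' (∃̇ x φ) (cv , upper , least) =
      cv , (λ w (d , hw) → upper w (d , Val-cong (update-cong (sym ∘ e≗e') x d) φ hw))
         , (λ u cu upper' → least u cu (λ w (d , hw) → upper' w (d , Val-cong (update-cong e≗e' x d) φ hw)))

    Val-functional : ∀ e φ {v w} → Val L N e φ v → Val L N e φ w → v ≡ w
    Val-functional e (atom P ts) hv hw = trans hv (sym hw)
    Val-functional e ⊥̇ hv hw = trans hv (sym hw)
    Val-functional e (φ &̇ ψ) (a , b , ha , hb , ev) (a' , b' , ha' , hb' , ew)
      rewrite Val-functional e φ ha ha' | Val-functional e ψ hb hb' = trans ev (sym ew)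
    Val-functional e (φ ∧̇ ψ) (a , b , ha , hb , ev) (a' , b' , ha' , hb' , ew)
      rewrite Val-functional e φ ha ha' | Val-functional e ψ hb hb' = trans ev (sym ew)
    Val-functional e (φ →̇ ψ) (a , b , ha , hb , ev) (a' , b' , ha' , hb' , ew)
      rewrite Val-functional e φ ha ha' | Val-functional e ψ hb hb' = trans ev (sym ew)
    Val-functional e (∀̇ x φ) {v} {w} (cv , lv , gv) (cw , lw , gw) = ℚP.≤-antisym (gw v cv lv) (gv w cw lw)
    Val-functional e (∃̇ x φ) {v} {w} (cv , uv , lv) (cw , uw , lw) = ℚP.≤-antisym (lv w cw uw) (lw v cv uv)

module Transfer {A B : Chain} (ρ : NMReduction A B) (L : Language) (M : Model L A) (safe : Safe L M) where
  open NMReduction ρ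
  open NMReductionProperties ρ
  open Model M

  image-model : Model L B
  image-model = record
    { Dom = Dom ; inhabit = inhabit ; const = const
    ; pred = λ P ds → proj₁ (image (pred∈A P ds))
    ; pred∈A = λ P ds → ↦-cod (proj₂ (image (pred∈A P ds))) }

  update-image : ∀ e x d → update L M e x d ≗ update L image-model e x d
  update-image e x d y with x ℕ.≟ y
  ... | yes _ = refl
  ... | no _ = refl

  IsInf-↦ : ∀ {S S' : ℚ → Set} {v v'}
    → (∀ {w} → S w → Σ ℚ λ w' → S' w' × w ↦ w')
    → (∀ {w'} → S' w' → Σ ℚ λ w → S w × w ↦ w')
    → IsInf L M S v → v ↦ v' → IsInf L image-model S' v'
  IsInf-↦ {v = v} {v'} forward backward (_ , lower , greatest) v↦v' = ↦-cod v↦v' , lower' , greatest'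
    where
    lower' : ∀ w' → _ → v' ≤ w'
    lower' w' hw' = let (w , hw , w↦w') = backward hw' in ↦-mono v↦v' w↦w' (lower w hw)
    greatest' : ∀ u → B u → (∀ w' → _ → u ≤ w') → u ≤ v'
    greatest' u bu lower-u with inf-lift bu
    ... | c , ac , c≤ , u≤ =
      let (c' , c↦c') = image ac
          c≤v = greatest c ac (λ w hw → let (w' , hw' , w↦w') = forward hw in c≤ w↦w' (lower-u w' hw'))
      in ℚP.≤-trans (u≤ c↦c') (↦-mono c↦c' v↦v' c≤v)

  IsSup-↦ : ∀ {S S' : ℚ → Set} {v v'}
    → (∀ {w} → S w → Σ ℚ λ w' → S' w' × w ↦ w')
    → (∀ {w'} → S' w' → Σ ℚ λ w → S w × w ↦ w')
    → IsSup L M S v → v ↦ v' → IsSup L image-model S' v'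
  IsSup-↦ {v = v} {v'} forward backward (_ , upper , least) v↦v' = ↦-cod v↦v' , upper' , least'
    where
    upper' : ∀ w' → _ → w' ≤ v'
    upper' w' hw' = let (w , hw , w↦w') = backward hw' in ↦-mono w↦w' v↦v' (upper w hw)
    least' : ∀ u → B u → (∀ w' → _ → w' ≤ u) → v' ≤ u
    least' u bu upper-u with sup-lift bu
    ... | c , ac , ≤c , ≤u =
      let (c' , c↦c') = image ac
          v≤c = least c ac (λ w hw → let (w' , hw' , w↦w') = forward hw in ≤c w↦w' (upper-u w' hw'))
      in ℚP.≤-trans (↦-mono v↦v' c↦c' v≤c) (≤u c↦c')

  mutual
    simulate : ∀ e φ {v} → Val L M e φ v → Σ ℚ λ v' → Val L image-model e φ v' × v ↦ v'
    simulate e (atom P ts) hv =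
      _ , refl , subst (_↦ _) (sym (trans hv (cong (pred P) (map-cong term-image ts)))) (proj₂ (image (pred∈A P _)))
      where
      term-image : ∀ t → termVal L M e t ≡ termVal L image-model e t
      term-image (var x) = refl
      term-image (con c) = refl
    simulate e ⊥̇ hv = 0ℚ , refl , subst (_↦ 0ℚ) (sym hv) 0↦0
    simulate e (φ &̇ ψ) (a , b , ha , hb , refl) =
      let (a' , ha' , ra) = simulate e φ ha ; (b' , hb' , rb) = simulate e ψ hb
      in _ , (a' , b' , ha' , hb' , refl) , ↦-⊛ ra rb
    simulate e (φ ∧̇ ψ) (a , b , ha , hb , refl) =
      let (a' , ha' , ra) = simulate e φ ha ; (b' , hb' , rb) = simulate e ψ hb
      in _ , (a' , b' , ha' , hb' , refl) , ↦-⊓ ra rb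
    simulate e (φ →̇ ψ) (a , b , ha , hb , refl) =
      let (a' , ha' , ra) = simulate e φ ha ; (b' , hb' , rb) = simulate e ψ hb
      in _ , (a' , b' , ha' , hb' , refl) , ↦-⇛ ra rb
    simulate e (∀̇ x φ) inf =
      let (v' , r) = image (proj₁ inf)
      in v' , IsInf-↦ (variant-forward e x φ) (variant-backward e x φ) inf r , r
    simulate e (∃̇ x φ) sup =
      let (v' , r) = image (proj₁ sup)
      in v' , IsSup-↦ (variant-forward e x φ) (variant-backward e x φ) sup r , r

    variant-forward : ∀ e x φ {w} → VariantValue L M e x φ w
      → Σ ℚ λ w' → VariantValue L image-model e x φ w' × w ↦ w'
    variant-forward e x φ (d , hw) =
      let (w' , hw' , r) = simulate (update L M e x d) φ hw
      in w' , (d , Val-cong L image-model (update-image e x d) φ hw') , r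

    -- Safety of M supplies a value in M for every variant, which simulates to the given one.
    variant-backward : ∀ e x φ {w'} → VariantValue L image-model e x φ w'
      → Σ ℚ λ w → VariantValue L M e x φ w × w ↦ w'
    variant-backward e x φ (d , hw') =
      let (w , hw) = safe (update L M e x d) φ
          (w'' , hw'' , r) = simulate (update L M e x d) φ hw
          w''≡w' = Val-functional L image-model _ φ (Val-cong L image-model (update-image e x d) φ hw'') hw'
      in w , (d , hw) , subst (w ↦_) w''≡w' r

  image-safe : Safe L image-model
  image-safe e φ = let (v , hv) = safe e φ ; (v' , hv' , _) = simulate e φ hv in v' , hv'

  taut-↦1 : ∀ {φ} → TAUT L B φ → ∀ e {v} → Val L M e φ v → v ↦ 1ℚ
  taut-↦1 {φ} taut e hv =
    let (v' , hv' , r) = simulate e φ hv in subst (_ ↦_) (taut image-model image-safe e v' hv') r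

Least : (ℕ → Set) → Set
Least P = Σ ℕ λ j → P j × (∀ {k} → P k → j ≤ₙ k)

module _ {P : ℕ → Set} (P? : Decidable P) where

  private
    search : ∀ m → (∀ {k} → k ≤ₙ m → ¬ P k) ⊎ Least P
    search zero with P? 0
    ... | yes p = inj₂ (0 , p , λ _ → z≤n)
    ... | no ¬p = inj₁ λ { z≤n → ¬p }
    search (suc m) with search m
    ... | inj₂ least = inj₂ least
    ... | inj₁ none with P? (suc m)
    ...   | yes p = inj₂ (suc m , p , λ pk → ℕP.≰⇒> (λ k≤m → none k≤m pk))
    ...   | no ¬p = inj₁ none≤suc
      where
      none≤suc : ∀ {k} → k ≤ₙ suc m → ¬ P k
      none≤suc k≤sm with ℕP.m≤n⇒m<n∨m≡n k≤sm
      ... | inj₁ k<sm = none (ℕP.≤-pred k<sm)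
      ... | inj₂ refl = ¬p

  least : ∀ {m} → P m → Least P
  least {m} pm with search m
  ... | inj₁ none = ⊥-elim (none ℕP.≤-refl pm)
  ... | inj₂ l = l

-- Describes the reduction sending the block [lower j, upper j] of A to label j (BlockReduction below);
-- only the two end blocks may contain more than one element.
record BlockPartition (A B : Chain) (m : ℕ) : Set where
  field
    lower upper label : ℕ → ℚ
    lower≤upper     : ∀ {j} → j ≤ₙ m → lower j ≤ upper j
    upper<lower     : ∀ {j} → j <ₙ m → upper j < lower (suc j)
    lower∈A         : ∀ {j} → j ≤ₙ m → A (lower j)
    lower-0         : lower 0 ≡ 0ℚ
    neg-lower       : ∀ {j} → j ≤ₙ m → neg (lower j) ≡ upper (m ∸ j)
    inner-singleton : ∀ {j} → 0 <ₙ j → j <ₙ m → lower j ≡ upper j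
    covers          : ∀ {a} → A a → Σ ℕ λ j → j ≤ₙ m × lower j ≤ a × a ≤ upper j
    A-neg           : ∀ {a} → A a → A (neg a)
    label-<         : ∀ {i j} → i <ₙ j → j ≤ₙ m → label i < label j
    label∈B         : ∀ {j} → j ≤ₙ m → B (label j)
    label-m         : label m ≡ 1ℚ
    neg-label       : ∀ {j} → j ≤ₙ m → neg (label j) ≡ label (m ∸ j)
    B-neg           : ∀ {u} → B u → B (neg u)
    B≤1             : ∀ {u} → B u → u ≤ 1ℚ

module BlockReduction {A B : Chain} {m : ℕ} (π : BlockPartition A B m) where
  open BlockPartition π

  InBlock : ℕ → ℚ → Set
  InBlock j a = j ≤ₙ m × lower j ≤ a × a ≤ upper j

  infix 4 _↦_
  _↦_ : ℚ → ℚ → Set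
  a ↦ b = A a × Σ ℕ λ j → InBlock j a × b ≡ label j

  upper<lower-trans : ∀ {i j} → i <ₙ j → j ≤ₙ m → upper i < lower j
  upper<lower-trans {i} {suc j} i<sj sj≤m with ℕP.m≤n⇒m<n∨m≡n (ℕP.≤-pred i<sj)
  ... | inj₂ refl = upper<lower sj≤m
  ... | inj₁ i<j = ℚP.<-trans (upper<lower-trans i<j (ℕP.<⇒≤ sj≤m))
                              (ℚP.≤-<-trans (lower≤upper (ℕP.<⇒≤ sj≤m)) (upper<lower sj≤m))

  lower-mono : ∀ {i j} → i ≤ₙ j → j ≤ₙ m → lower i ≤ lower j
  lower-mono i≤j j≤m with ℕP.m≤n⇒m<n∨m≡n i≤j
  ... | inj₂ refl = ℚP.≤-refl
  ... | inj₁ i<j = ℚP.≤-trans (lower≤upper (ℕP.≤-trans i≤j j≤m)) (ℚP.<⇒≤ (upper<lower-trans i<j j≤m))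

  blocks-ordered : ∀ {i j a a'} → InBlock i a → InBlock j a' → a ≤ a' → i ≤ₙ j
  blocks-ordered {i} {j} (i≤m , li≤a , _) (_ , _ , a'≤uj) a≤a' with i ℕ.≤? j
  ... | yes i≤j = i≤j
  ... | no i≰j = ⊥-elim (ℚP.<-irrefl refl
          (ℚP.<-≤-trans (upper<lower-trans (ℕP.≰⇒> i≰j) i≤m) (ℚP.≤-trans li≤a (ℚP.≤-trans a≤a' a'≤uj))))

  block-unique : ∀ {i j a} → InBlock i a → InBlock j a → i ≡ j
  block-unique bi bj = ℕP.≤-antisym (blocks-ordered bi bj ℚP.≤-refl) (blocks-ordered bj bi ℚP.≤-refl)

  label-mono : ∀ {i j} → i ≤ₙ j → j ≤ₙ m → label i ≤ label j
  label-mono i≤j j≤m with ℕP.m≤n⇒m<n∨m≡n i≤j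
  ... | inj₁ i<j = ℚP.<⇒≤ (label-< i<j j≤m)
  ... | inj₂ refl = ℚP.≤-refl

  label-injective : ∀ {i j} → i ≤ₙ m → j ≤ₙ m → label i ≡ label j → i ≡ j
  label-injective {i} {j} i≤m j≤m li≡lj with ℕP.<-cmp i j
  ... | tri< i<j _ _ = ⊥-elim (ℚP.<-irrefl li≡lj (label-< i<j j≤m))
  ... | tri≈ _ i≡j _ = i≡j
  ... | tri> _ _ j<i = ⊥-elim (ℚP.<-irrefl (sym li≡lj) (label-< j<i i≤m))

  label-0 : label 0 ≡ 0ℚ
  label-0 = begin
    label 0        ≡⟨ cong label (sym (ℕP.n∸n≡0 m)) ⟩
    label (m ∸ m)  ≡⟨ sym (neg-label ℕP.≤-refl) ⟩
    neg (label m)  ≡⟨ cong neg label-m ⟩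
    0ℚ             ∎
    where open ≡-Reasoning

  neg-upper : ∀ {j} → j ≤ₙ m → neg (upper j) ≡ lower (m ∸ j)
  neg-upper {j} j≤m = begin
    neg (upper j)                  ≡⟨ cong (neg ∘ upper) (sym (ℕP.m∸[m∸n]≡n j≤m)) ⟩
    neg (upper (m ∸ (m ∸ j)))      ≡⟨ cong neg (sym (neg-lower (ℕP.m∸n≤m m j))) ⟩
    neg (neg (lower (m ∸ j)))      ≡⟨ neg-involutive (lower (m ∸ j)) ⟩
    lower (m ∸ j)                  ∎
    where open ≡-Reasoning

  ↦-mono : ∀ {a b a' b'} → a ↦ b → a' ↦ b' → a ≤ a' → b ≤ b'
  ↦-mono (_ , _ , bj , refl) (_ , _ , bj' , refl) a≤a' = label-mono (blocks-ordered bj bj' a≤a') (proj₁ bj')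

  ↦-neg : ∀ {a b} → a ↦ b → neg a ↦ neg b
  ↦-neg {a} (aa , j , (j≤m , lj≤a , a≤uj) , refl) =
    A-neg aa , m ∸ j ,
    (ℕP.m∸n≤m m j , subst (_≤ neg a) (neg-upper j≤m) (neg-antitone a≤uj) ,
                    subst (neg a ≤_) (neg-lower j≤m) (neg-antitone lj≤a)) ,
    neg-label j≤m

  fibre-0or1 : ∀ {a a' b} → a ↦ b → a' ↦ b → a < a' → Is0or1 b
  fibre-0or1 {a} {a'} (_ , j , (j≤m , lj≤a , _) , refl) (_ , j' , (j'≤m , _ , a'≤uj') , lj≡lj') a<a'
    with label-injective j'≤m j≤m (sym lj≡lj')
  ... | refl with j ℕ.≟ 0 | j ℕ.≟ m
  ...   | yes refl | _ = inj₁ label-0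
  ...   | no _ | yes refl = inj₂ label-m
  ...   | no j≢0 | no j≢m = ⊥-elim (ℚP.<-irrefl refl (ℚP.<-≤-trans a<a' a'≤a))
    where
    a'≤a : a' ≤ a
    a'≤a = ℚP.≤-trans a'≤uj' (ℚP.≤-trans (ℚP.≤-reflexive (sym (inner-singleton (ℕP.n≢0⇒n>0 j≢0) (ℕP.≤∧≢⇒< j≤m j≢m)))) lj≤a)

  -- c is the lower end of the least block whose label is ≥ u.
  inf-lift : ∀ {u} → B u → Σ ℚ λ c → A c
               × (∀ {a b} → a ↦ b → u ≤ b → c ≤ a) × (∀ {b} → c ↦ b → u ≤ b)
  inf-lift {u} bu with least (λ k → u ℚP.≤? label k) {m} (subst (u ≤_) (sym label-m) (B≤1 bu))
  ... | j , u≤lj , minimal = lower j , lower∈A j≤m , lower-bound , above-u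
    where
    j≤m : j ≤ₙ m
    j≤m = minimal (subst (u ≤_) (sym label-m) (B≤1 bu))
    lower-bound : ∀ {a b} → a ↦ b → u ≤ b → lower j ≤ a
    lower-bound (_ , j' , (j'≤m , lj'≤a , _) , refl) u≤lj' = ℚP.≤-trans (lower-mono (minimal u≤lj') j'≤m) lj'≤a
    above-u : ∀ {b} → lower j ↦ b → u ≤ b
    above-u (_ , j' , bj' , refl) rewrite block-unique bj' (j≤m , ℚP.≤-refl , lower≤upper j≤m) = u≤lj

  -- Suprema reduce to infima through the symmetry n.
  sup-lift : ∀ {u} → B u → Σ ℚ λ c → A c
               × (∀ {a b} → a ↦ b → b ≤ u → a ≤ c) × (∀ {b} → c ↦ b → b ≤ u)
  sup-lift {u} bu with inf-lift (B-neg bu)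
  ... | c , ac , c≤ , nu≤ = neg c , A-neg ac , below-nc , below-u
    where
    below-nc : ∀ {a b} → a ↦ b → b ≤ u → a ≤ neg c
    below-nc {a} r b≤u = subst (_≤ neg c) (neg-involutive a) (neg-antitone (c≤ (↦-neg r) (neg-antitone b≤u)))
    below-u : ∀ {b} → neg c ↦ b → b ≤ u
    below-u {b} r = subst₂ _≤_ (neg-involutive b) (neg-involutive u)
                      (neg-antitone (nu≤ (subst (_↦ neg b) (neg-involutive c) (↦-neg r))))

  reduction : NMReduction A B
  reduction = record
    { _↦_ = _↦_
    ; ↦-dom = proj₁
    ; ↦-cod = λ { (_ , j , (j≤m , _) , refl) → label∈B j≤m }
    ; image = λ aa → let (j , bj) = covers aa in label j , aa , j , bj , refl
    ; ↦-mono = ↦-mono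
    ; ↦-neg = ↦-neg
    ; 0↦0 = subst A lower-0 (lower∈A z≤n) , 0 ,
            (z≤n , ℚP.≤-reflexive lower-0 , subst (_≤ upper 0) lower-0 (lower≤upper z≤n)) , sym label-0
    ; fibre-0or1 = fibre-0or1
    ; inf-lift = inf-lift
    ; sup-lift = sup-lift
    }

  ↦-label : ∀ {a j} → a ↦ label j → j ≤ₙ m → InBlock j a
  ↦-label (_ , j' , bj' , lj≡lj') j≤m rewrite label-injective j≤m (proj₁ bj') lj≡lj' = bj'

-- frac a b = a / (b + 1), opaque so that the gcd normalisation of _/_ is never unfolded.
opaque
  frac : ℕ → ℕ → ℚ
  frac a b = (+ a) / suc b

  frac-def : ∀ a b → frac a b ≡ (+ a) / suc b
  frac-def a b = refl

  toℚᵘ-frac : ∀ a b → toℚᵘ (frac a b) U.≃ U.mkℚᵘ (+ a) b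
  toℚᵘ-frac a b = ℚP.toℚᵘ-fromℚᵘ (U.mkℚᵘ (+ a) b)

  frac-0 : frac 0 0 ≡ 0ℚ
  frac-0 = refl

  frac-1 : frac 1 0 ≡ 1ℚ
  frac-1 = refl

frac-≤ : ∀ {a b c d} → a ℕ.* suc d ≤ₙ c ℕ.* suc b → frac a b ≤ frac c d
frac-≤ {a} {b} {c} {d} h = ℚP.toℚᵘ-cancel-≤
  (UP.≤-respʳ-≃ (UP.≃-sym (toℚᵘ-frac c d)) (UP.≤-respˡ-≃ (UP.≃-sym (toℚᵘ-frac a b))
    (U.*≤* (subst₂ ℤ._≤_ (ℤP.pos-* a (suc d)) (ℤP.pos-* c (suc b)) (ℤ.+≤+ h)))))

frac-≤⁻ : ∀ {a b c d} → frac a b ≤ frac c d → a ℕ.* suc d ≤ₙ c ℕ.* suc b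
frac-≤⁻ {a} {b} {c} {d} h with UP.≤-respʳ-≃ (toℚᵘ-frac c d) (UP.≤-respˡ-≃ (toℚᵘ-frac a b) (ℚP.toℚᵘ-mono-≤ h))
... | U.*≤* q = ℤP.drop‿+≤+ (subst₂ ℤ._≤_ (sym (ℤP.pos-* a (suc d))) (sym (ℤP.pos-* c (suc b))) q)

frac-< : ∀ {a b c d} → a ℕ.* suc d <ₙ c ℕ.* suc b → frac a b < frac c d
frac-< {a} {b} {c} {d} h = ℚP.≰⇒> (λ h' → ℕP.<⇒≱ h (frac-≤⁻ {c} {d} {a} {b} h'))

frac-≡ : ∀ {a b c d} → a ℕ.* suc d ≡ c ℕ.* suc b → frac a b ≡ frac c d
frac-≡ {a} {b} {c} {d} e =
  ℚP.≤-antisym (frac-≤ {a} {b} {c} {d} (ℕP.≤-reflexive e)) (frac-≤ {c} {d} {a} {b} (ℕP.≤-reflexive (sym e)))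

neg-frac : ∀ {a b c} → a + c ≡ suc b → neg (frac a b) ≡ frac c b
neg-frac {a} {b} {c} a+c≡sb = ℚP.toℚᵘ-injective (begin
  toℚᵘ (1ℚ - frac a b)             ≈⟨ ℚP.toℚᵘ-homo-+ 1ℚ (ℚ.- frac a b) ⟩
  U.1ℚᵘ U.+ toℚᵘ (ℚ.- frac a b)    ≈⟨ UP.+-congʳ U.1ℚᵘ (UP.≃-trans (ℚP.toℚᵘ-homo‿- (frac a b)) (UP.-‿cong (toℚᵘ-frac a b))) ⟩
  U.1ℚᵘ U.- U.mkℚᵘ (+ a) b         ≈⟨ U.*≡* (cross (+ a) (+ c) (sym sb≡) (sym (trans (cong +_ (ℕP.*-identityˡ (suc b))) sb≡))) ⟩
  U.mkℚᵘ (+ c) b                   ≈⟨ UP.≃-sym (toℚᵘ-frac c b) ⟩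
  toℚᵘ (frac c b)                  ∎)
  where
  open UP.≃-Reasoning
  sb≡ : + suc b ≡ + a ℤ.+ + c
  sb≡ = trans (cong +_ (sym a+c≡sb)) (ℤP.pos-+ a c)
  identity : ∀ (x y : ℤ.ℤ) → ((+ 1) ℤ.* (x ℤ.+ y) ℤ.+ (ℤ.- x) ℤ.* (+ 1)) ℤ.* (x ℤ.+ y) ≡ y ℤ.* (x ℤ.+ y)
  identity = ℤSolver.solve-∀
  cross : ∀ x y {s t} → x ℤ.+ y ≡ s → x ℤ.+ y ≡ t → ((+ 1) ℤ.* s ℤ.+ (ℤ.- x) ℤ.* (+ 1)) ℤ.* s ≡ y ℤ.* t
  cross x y refl refl = identity x y

toℚᵘ-integer : ∀ n → toℚᵘ ((+ n) / 1) U.≃ U.mkℚᵘ (+ n) 0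
toℚᵘ-integer n = subst (λ z → toℚᵘ z U.≃ U.mkℚᵘ (+ n) 0) (frac-def n 0) (toℚᵘ-frac n 0)

frac-*-suc : ∀ i b → frac i b * ((+ suc b) / 1) ≡ (+ i) / 1
frac-*-suc i b = ℚP.toℚᵘ-injective (begin
  toℚᵘ (frac i b * ((+ suc b) / 1))          ≈⟨ ℚP.toℚᵘ-homo-* (frac i b) _ ⟩
  toℚᵘ (frac i b) U.* toℚᵘ ((+ suc b) / 1)    ≈⟨ UP.*-cong (toℚᵘ-frac i b) (toℚᵘ-integer (suc b)) ⟩
  U.mkℚᵘ (+ i) b U.* U.mkℚᵘ (+ suc b) 0      ≈⟨ U.*≡* (trans (ℤP.*-identityʳ _) (cong ((+ i) ℤ.*_) (cong +_ (sym (ℕP.*-identityʳ (suc b)))))) ⟩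
  U.mkℚᵘ (+ i) 0                              ≈⟨ UP.≃-sym (toℚᵘ-integer i) ⟩
  toℚᵘ ((+ i) / 1)                            ∎)
  where open UP.≃-Reasoning

low high : ℕ → ℚ
low k = frac 1 k
high k = frac k k

neg-low : ∀ k → neg (low k) ≡ high k
neg-low k = neg-frac refl

neg-high : ∀ k → neg (high k) ≡ low k
neg-high k = trans (cong neg (sym (neg-low k))) (neg-involutive (low k))

low∈NM∞ : ∀ k → NM∞ (low k)
low∈NM∞ k = k , inj₁ (frac-def 1 k)

high∈NM∞ : ∀ k → NM∞ (high k)
high∈NM∞ k = k , inj₂ (trans (sym (neg-low k)) (cong neg (frac-def 1 k)))

NM∞-cases : ∀ {q} → NM∞ q → Σ ℕ λ k → q ≡ low k ⊎ q ≡ high k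
NM∞-cases (k , inj₁ q≡) = k , inj₁ (trans q≡ (sym (frac-def 1 k)))
NM∞-cases (k , inj₂ q≡) = k , inj₂ (trans q≡ (trans (cong neg (sym (frac-def 1 k))) (neg-low k)))

NM∞-neg : ∀ {q} → NM∞ q → NM∞ (neg q)
NM∞-neg q∈ with NM∞-cases q∈
... | k , inj₁ refl = subst NM∞ (sym (neg-low k)) (high∈NM∞ k)
... | k , inj₂ refl = subst NM∞ (sym (neg-high k)) (low∈NM∞ k)

0≤frac : ∀ a b → 0ℚ ≤ frac a b
0≤frac a b = subst (_≤ frac a b) frac-0 (frac-≤ {0} {0} {a} {b} z≤n)

frac≤1 : ∀ {a b} → a ≤ₙ suc b → frac a b ≤ 1ℚ
frac≤1 {a} {b} a≤sb = subst (frac a b ≤_) frac-1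
  (frac-≤ {a} {b} {1} {0} (subst₂ _≤ₙ_ (sym (ℕP.*-identityʳ a)) (sym (ℕP.*-identityˡ (suc b))) a≤sb))

NM∞⊆[0,1] : ∀ {q} → NM∞ q → 0ℚ ≤ q × q ≤ 1ℚ
NM∞⊆[0,1] q∈ with NM∞-cases q∈
... | k , inj₁ refl = 0≤frac 1 k , frac≤1 (s≤s z≤n)
... | k , inj₂ refl = 0≤frac k k , frac≤1 (ℕP.n≤1+n k)

low-< : ∀ {a b} → b <ₙ a → low a < low b
low-< {a} {b} b<a = frac-< {1} {a} {1} {b}
  (subst₂ _<ₙ_ (sym (ℕP.*-identityˡ (suc b))) (sym (ℕP.*-identityˡ (suc a))) (s≤s b<a))

high-< : ∀ {a b} → a <ₙ b → high a < high b
high-< {a} {b} a<b = frac-< {a} {a} {b} {b} (subst₂ _<ₙ_ (sym (ℕP.*-suc a b))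
  (trans (cong (λ z → b + z) (ℕP.*-comm a b)) (sym (ℕP.*-suc b a))) (ℕP.+-monoˡ-< (a ℕ.* b) a<b))

low-≤ : ∀ {a b} → b ≤ₙ a → low a ≤ low b
low-≤ b≤a with ℕP.m≤n⇒m<n∨m≡n b≤a
... | inj₁ b<a = ℚP.<⇒≤ (low-< b<a)
... | inj₂ refl = ℚP.≤-refl

high-≤ : ∀ {a b} → a ≤ₙ b → high a ≤ high b
high-≤ a≤b with ℕP.m≤n⇒m<n∨m≡n a≤b
... | inj₁ a<b = ℚP.<⇒≤ (high-< a<b)
... | inj₂ refl = ℚP.≤-refl

high<1 : ∀ k → high k < 1ℚ
high<1 k = subst (high k <_) frac-1
  (frac-< {k} {k} {1} {0} (subst₂ _<ₙ_ (sym (ℕP.*-identityʳ k)) (sym (ℕP.*-identityˡ (suc k))) (ℕP.n<1+n k)))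

0<low : ∀ k → 0ℚ < low k
0<low k = subst (_< low k) frac-0 (frac-< {0} {0} {1} {k} (s≤s z≤n))

-- ladder N i (i ≤ 2N) enumerates 0, 1/(N+1), …, 1/2, …, N/(N+1), 1: a copy of NM_(2N+1) inside NM∞.
ladder : ℕ → ℕ → ℚ
ladder N zero = 0ℚ
ladder N i@(suc _) with i ℕ.≤? N | (N + N) ℕ.≤? i
... | yes _ | _ = low (suc (N ∸ i))
... | no _ | yes _ = 1ℚ
... | no _ | no _ = high (suc (i ∸ N))

ladder-low : ∀ {N i} → 1 ≤ₙ i → i ≤ₙ N → ladder N i ≡ low (suc (N ∸ i))
ladder-low {N} {suc i} _ i≤N with suc i ℕ.≤? N
... | yes _ = refl
... | no i≰N = ⊥-elim (i≰N i≤N)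

low≡high-at-centre : ∀ {N i} → i ≡ N → low (suc (N ∸ i)) ≡ high (suc (i ∸ N))
low≡high-at-centre {N} refl rewrite ℕP.n∸n≡0 N = refl

ladder-high : ∀ {N i} → N ≤ₙ i → i <ₙ N + N → ladder N i ≡ high (suc (i ∸ N))
ladder-high {zero} {i} _ ()
ladder-high {suc N} {suc i} N≤i i<2N with suc i ℕ.≤? suc N | (suc N + suc N) ℕ.≤? suc i
... | yes i≤N | _ = low≡high-at-centre (ℕP.≤-antisym i≤N N≤i)
... | no _ | yes 2N≤i = ⊥-elim (ℕP.<⇒≱ i<2N 2N≤i)
... | no _ | no _ = refl

ladder-top : ∀ {N} → 1 ≤ₙ N → ladder N (N + N) ≡ 1ℚ
ladder-top {suc N} _ with suc N + suc N ℕ.≤? suc N | (suc N + suc N) ℕ.≤? (suc N + suc N)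
... | yes 2N≤N | _ = ⊥-elim (ℕP.<⇒≱ (ℕP.m<m+n (suc N) (s≤s z≤n)) 2N≤N)
... | no _ | yes _ = refl
... | no _ | no 2N≰2N = ⊥-elim (2N≰2N ℕP.≤-refl)

ladder∈NM∞ : ∀ N i → NM∞ (ladder N i)
ladder∈NM∞ N zero = subst NM∞ frac-0 (high∈NM∞ 0)
ladder∈NM∞ N i@(suc _) with i ℕ.≤? N | (N + N) ℕ.≤? i
... | yes _ | _ = low∈NM∞ _
... | no _ | yes _ = subst NM∞ frac-1 (low∈NM∞ 0)
... | no _ | no _ = high∈NM∞ _

ladder⊆[0,1] : ∀ N i → 0ℚ ≤ ladder N i × ladder N i ≤ 1ℚ
ladder⊆[0,1] N i = NM∞⊆[0,1] (ladder∈NM∞ N i)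

ladder-step : ∀ {N} → 1 ≤ₙ N → ∀ i → suc i ≤ₙ N + N → ladder N i < ladder N (suc i)
ladder-step {N} 1≤N zero _ = subst (0ℚ <_) (sym (ladder-low ℕP.≤-refl 1≤N)) (0<low _)
ladder-step {N} 1≤N (suc i) ssi≤2N with N ℕ.≤? suc i
... | no N≰si = subst₂ _<_ (sym (ladder-low (s≤s z≤n) (ℕP.<⇒≤ ssi≤N))) (sym (ladder-low (s≤s z≤n) ssi≤N))
                  (low-< (s≤s (ℕP.≤-reflexive (sym (ℕP.+-∸-assoc 1 ssi≤N)))))
  where
  ssi≤N : suc (suc i) ≤ₙ N
  ssi≤N = ℕP.≰⇒> N≰si
... | yes N≤si with ℕP.m≤n⇒m<n∨m≡n ssi≤2N
...   | inj₁ ssi<2N = subst₂ _<_ (sym (ladder-high N≤si (ℕP.<⇒≤ ssi<2N))) (sym (ladder-high (ℕP.m≤n⇒m≤1+n N≤si) ssi<2N))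
                        (high-< (s≤s (ℕP.≤-reflexive (sym (ℕP.+-∸-assoc 1 N≤si)))))
...   | inj₂ ssi≡2N = subst₂ _<_ (sym (ladder-high N≤si (subst (suc i <ₙ_) ssi≡2N ℕP.≤-refl)))
                        (sym (trans (cong (ladder N) ssi≡2N) (ladder-top 1≤N))) (high<1 _)

ladder-< : ∀ {N} → 1 ≤ₙ N → ∀ {i j} → i <ₙ j → j ≤ₙ N + N → ladder N i < ladder N j
ladder-< 1≤N {i} {suc j} i<sj sj≤2N with ℕP.m≤n⇒m<n∨m≡n (ℕP.≤-pred i<sj)
... | inj₂ refl = ladder-step 1≤N i sj≤2N
... | inj₁ i<j = ℚP.<-trans (ladder-< 1≤N i<j (ℕP.<⇒≤ sj≤2N)) (ladder-step 1≤N j sj≤2N)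

neg-ladder-lower : ∀ {N i} → 1 ≤ₙ N → i ≤ₙ N → neg (ladder N i) ≡ ladder N ((N + N) ∸ i)
neg-ladder-lower {N} {zero} 1≤N _ = sym (ladder-top 1≤N)
neg-ladder-lower {N} {i@(suc _)} 1≤N i≤N = begin
  neg (ladder N i)                 ≡⟨ cong neg (ladder-low (s≤s z≤n) i≤N) ⟩
  neg (low (suc (N ∸ i)))          ≡⟨ neg-low _ ⟩
  high (suc (N ∸ i))               ≡⟨ cong (high ∘ suc) (sym (ℕP.m+n∸m≡n N (N ∸ i))) ⟩
  high (suc (N + (N ∸ i) ∸ N))     ≡⟨ sym (ladder-high (ℕP.m≤m+n N _) (ℕP.+-monoʳ-< N (ℕP.∸-monoʳ-< (s≤s z≤n) i≤N))) ⟩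
  ladder N (N + (N ∸ i))           ≡⟨ cong (ladder N) (sym (ℕP.+-∸-assoc N i≤N)) ⟩
  ladder N ((N + N) ∸ i)           ∎
  where open ≡-Reasoning

-- The upper half follows from the lower half by the involutivity of n.
neg-ladder : ∀ {N i} → 1 ≤ₙ N → i ≤ₙ N + N → neg (ladder N i) ≡ ladder N ((N + N) ∸ i)
neg-ladder {N} {i} 1≤N i≤2N with i ℕ.≤? N
... | yes i≤N = neg-ladder-lower 1≤N i≤N
... | no i≰N = begin
  neg (ladder N i)                         ≡⟨ cong (neg ∘ ladder N) (sym (ℕP.m∸[m∸n]≡n i≤2N)) ⟩
  neg (ladder N ((N + N) ∸ j))             ≡⟨ cong neg (sym (neg-ladder-lower 1≤N j≤N)) ⟩
  neg (neg (ladder N j))                   ≡⟨ neg-involutive _ ⟩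
  ladder N j                               ∎
  where
  open ≡-Reasoning
  j : ℕ
  j = (N + N) ∸ i
  N≤i : N ≤ₙ i
  N≤i = ℕP.<⇒≤ (ℕP.≰⇒> i≰N)
  j≤N : j ≤ₙ N
  j≤N = subst (_≤ₙ N) (trans (sym (ℕP.[m+n]∸[m+o]≡n∸o N N (i ∸ N))) (cong ((N + N) ∸_) (ℕP.m+[n∸m]≡n N≤i)))
          (ℕP.m∸n≤m N (i ∸ N))

-- NM_(n+2) consists of the points j/(n+1), j ≤ n + 1.
module NMPoints (n : ℕ) where

  point : ℕ → ℚ
  point j = frac j n

  point∈NM : ∀ {j} → j ≤ₙ suc n → NM (suc (suc n)) (point j)
  point∈NM {j} j≤ = j , j≤ , frac-*-suc j n

  point-< : ∀ {i j} → i <ₙ j → point i < point j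
  point-< {i} {j} i<j = frac-< {i} {n} {j} {n} (ℕP.*-monoˡ-< (suc n) i<j)

  point-≤ : ∀ {i j} → i ≤ₙ j → point i ≤ point j
  point-≤ {i} {j} i≤j = frac-≤ {i} {n} {j} {n} (ℕP.*-monoˡ-≤ (suc n) i≤j)

  neg-point : ∀ {j} → j ≤ₙ suc n → neg (point j) ≡ point (suc n ∸ j)
  neg-point j≤ = neg-frac (ℕP.m+[n∸m]≡n j≤)

  point-0 : point 0 ≡ 0ℚ
  point-0 = trans (frac-≡ {0} {n} {0} {0} refl) frac-0

  point-top : point (suc n) ≡ 1ℚ
  point-top = trans (frac-≡ {suc n} {n} {1} {0} (trans (ℕP.*-identityʳ (suc n)) (sym (ℕP.*-identityˡ (suc n))))) frac-1

  NM-cases : ∀ {q} → NM (suc (suc n)) q → Σ ℕ λ j → j ≤ₙ suc n × q ≡ point j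
  NM-cases {q} (j , j≤ , q*sn≡j) =
    j , j≤ , ℚP.≤-antisym (cancel (ℚP.≤-reflexive q*sn≡pj*sn)) (cancel (ℚP.≤-reflexive (sym q*sn≡pj*sn)))
    where
    sn : ℚ
    sn = (+ suc n) / 1
    instance
      sn-positive : ℚ.Positive sn
      sn-positive = ℚ.positive (subst₂ _<_ frac-0 (frac-def (suc n) 0) (frac-< {0} {0} {suc n} {0} (s≤s z≤n)))
    q*sn≡pj*sn : q * sn ≡ point j * sn
    q*sn≡pj*sn = trans q*sn≡j (sym (frac-*-suc j n))
    cancel : ∀ {x y} → x * sn ≤ y * sn → x ≤ y
    cancel = ℚP.*-cancelʳ-≤-pos sn

  NM≤1 : ∀ {q} → NM (suc (suc n)) q → q ≤ 1ℚ
  NM≤1 {q} q∈ with NM-cases {q} q∈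
  ... | j , j≤ , refl = subst (point j ≤_) point-top (point-≤ j≤)

  NM-neg : ∀ {q} → NM (suc (suc n)) q → NM (suc (suc n)) (neg q)
  NM-neg {q} q∈ with NM-cases {q} q∈
  ... | j , j≤ , refl = subst (NM (suc (suc n))) (sym (neg-point j≤)) (point∈NM (ℕP.m∸n≤m (suc n) j))

double-∸ : ∀ m j → j ≤ₙ m → (m + m) ∸ (j + j) ≡ (m ∸ j) + (m ∸ j)
double-∸ m j j≤m = begin
  (m + m) ∸ (j + j)                           ≡⟨ cong (λ z → (z + z) ∸ (j + j)) (sym (ℕP.m+[n∸m]≡n j≤m)) ⟩
  ((j + d) + (j + d)) ∸ (j + j)               ≡⟨ cong (_∸ (j + j)) (interchange j d) ⟩
  ((j + j) + (d + d)) ∸ (j + j)               ≡⟨ ℕP.m+n∸m≡n (j + j) (d + d) ⟩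
  d + d                                       ∎
  where
  open ≡-Reasoning
  d : ℕ
  d = m ∸ j
  interchange : ∀ a b → (a + b) + (a + b) ≡ (a + a) + (b + b)
  interchange = ℕSolver.solve-∀

module Embedding (m' : ℕ) where
  open NMPoints m'
  m : ℕ
  m = suc m'

  partition : BlockPartition (NM (suc m)) NM∞ m
  partition = record
    { lower = point ; upper = point ; label = λ j → ladder m (j + j)
    ; lower≤upper = λ _ → ℚP.≤-refl
    ; upper<lower = λ {j} _ → point-< (ℕP.n<1+n j)
    ; lower∈A = point∈NM
    ; lower-0 = point-0
    ; neg-lower = neg-point
    ; inner-singleton = λ _ _ → refl
    ; covers = λ {a} a∈ → let (j , j≤m , a≡pj) = NM-cases {a} a∈
                          in j , j≤m , ℚP.≤-reflexive (sym a≡pj) , ℚP.≤-reflexive a≡pj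
    ; A-neg = λ {a} → NM-neg {a}
    ; label-< = λ i<j j≤m → ladder-< (s≤s z≤n) (ℕP.+-mono-< i<j i<j) (ℕP.+-mono-≤ j≤m j≤m)
    ; label∈B = λ {j} _ → ladder∈NM∞ m (j + j)
    ; label-m = ladder-top {m} (s≤s z≤n)
    ; neg-label = λ {j} j≤m → trans (neg-ladder (s≤s z≤n) (ℕP.+-mono-≤ j≤m j≤m)) (cong (ladder m) (double-∸ m j j≤m))
    ; B-neg = λ {u} → NM∞-neg {u}
    ; B≤1 = λ {u} u∈ → proj₂ (NM∞⊆[0,1] {u} u∈)
    }

  open BlockPartition partition using (label-m)
  open BlockReduction partition public using (reduction; _↦_; ↦-label)

  ↦1⇒≡1 : ∀ {a} → a ↦ 1ℚ → a ≡ 1ℚ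
  ↦1⇒≡1 {a} a↦1 with ↦-label (subst (a ↦_) (sym label-m) a↦1) ℕP.≤-refl
  ... | _ , pm≤a , a≤pm = trans (ℚP.≤-antisym a≤pm pm≤a) point-top

-- NM∞ maps onto NM_(2N+1) (N = k + 1): the rungs 1/(N+2) < … < (N+1)/(N+2) of the ladder go in order
-- to the points of NM_(2N+1), everything below them to 0 and everything above them to 1.
module Collapse (k : ℕ) where
  N K m : ℕ
  N = suc k
  K = suc N
  m = N + N
  open NMPoints (k + suc k)

  1≤K : 1 ≤ₙ K
  1≤K = s≤s z≤n

  lower : ℕ → ℚ
  lower zero = 0ℚ
  lower (suc j) = ladder K (suc (suc j))

  upper : ℕ → ℚ
  upper j with j ℕ.≟ m
  ... | yes _ = 1ℚ
  ... | no _ = ladder K (suc j)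

  upper-inner : ∀ {j} → j ≢ m → upper j ≡ ladder K (suc j)
  upper-inner {j} j≢m with j ℕ.≟ m
  ... | yes j≡m = ⊥-elim (j≢m j≡m)
  ... | no _ = refl

  upper-m : upper m ≡ 1ℚ
  upper-m with m ℕ.≟ m
  ... | yes _ = refl
  ... | no m≢m = ⊥-elim (m≢m refl)

  rung-bound : ∀ {j} → j ≤ₙ m → suc j ≤ₙ K + K
  rung-bound j≤m = s≤s (ℕP.≤-trans j≤m (ℕP.+-monoʳ-≤ N (ℕP.n≤1+n N)))

  top-rung : ladder K (suc m) ≡ high K
  top-rung = trans (ladder-high (s≤s (ℕP.m≤m+n N N)) (s≤s (ℕP.≤-reflexive (sym (ℕP.+-suc N N)))))
                   (cong (high ∘ suc) (ℕP.m+n∸m≡n N N))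

  Covered : ℚ → Set
  Covered a = Σ ℕ λ j → j ≤ₙ m × lower j ≤ a × a ≤ upper j

  bottom-covered : ∀ {a} → 0ℚ ≤ a → a ≤ ladder K 1 → Covered a
  bottom-covered {a} 0≤a a≤r1 = 0 , z≤n , 0≤a , subst (a ≤_) (sym (upper-inner {0} (λ ()))) a≤r1

  top-covered : ∀ {a} → ladder K (suc m) ≤ a → a ≤ 1ℚ → Covered a
  top-covered {a} r≤a a≤1 = m , ℕP.≤-refl , r≤a , subst (a ≤_) (sym upper-m) a≤1

  lower≤rung : ∀ j → lower j ≤ ladder K (suc j)
  lower≤rung zero = proj₁ (ladder⊆[0,1] K 1)
  lower≤rung (suc j) = ℚP.≤-refl

  rung≤upper : ∀ j → ladder K (suc j) ≤ upper j
  rung≤upper j with j ℕ.≟ m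
  ... | yes _ = proj₂ (ladder⊆[0,1] K (suc j))
  ... | no _ = ℚP.≤-refl

  rung-covered : ∀ {j} → j ≤ₙ m → Covered (ladder K (suc j))
  rung-covered {j} j≤m = j , j≤m , lower≤rung j , rung≤upper j

  low-covered : ∀ k' → Covered (low (suc k'))
  low-covered k' with k' ℕ.<? K
  ... | yes k'<K = subst Covered rung≡low (rung-covered (ℕP.≤-trans (ℕP.m∸n≤m N k') (ℕP.m≤m+n N N)))
    where
    rung≡low : ladder K (suc (N ∸ k')) ≡ low (suc k')
    rung≡low = trans (cong (ladder K) (sym (ℕP.+-∸-assoc 1 (ℕP.≤-pred k'<K))))
                 (trans (ladder-low (ℕP.m<n⇒0<n∸m k'<K) (ℕP.m∸n≤m K k'))
                        (cong (low ∘ suc) (ℕP.m∸[m∸n]≡n (ℕP.<⇒≤ k'<K))))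
  ... | no k'≮K = bottom-covered (ℚP.<⇒≤ (0<low _)) (low-≤ (ℕP.m≤n⇒m≤1+n (ℕP.≮⇒≥ k'≮K)))

  high-covered : ∀ k' → Covered (high (suc k'))
  high-covered k' with k' ℕ.<? K
  ... | yes k'<K = subst Covered rung≡high (rung-covered (ℕP.+-monoʳ-≤ N (ℕP.≤-pred k'<K)))
    where
    rung≡high : ladder K (suc (N + k')) ≡ high (suc k')
    rung≡high = trans (ladder-high (ℕP.m≤m+n K k') (ℕP.+-monoʳ-< K k'<K)) (cong (λ z → high (suc z)) (ℕP.m+n∸m≡n K k'))
  ... | no k'≮K = top-covered (subst (_≤ high (suc k')) (sym top-rung) (high-≤ (ℕP.m≤n⇒m≤1+n (ℕP.≮⇒≥ k'≮K))))
                             (proj₂ (NM∞⊆[0,1] (high∈NM∞ (suc k'))))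

  covers : ∀ {a} → NM∞ a → Covered a
  covers {a} a∈ with NM∞-cases {a} a∈
  ... | zero , inj₁ refl = top-covered (subst (ladder K (suc m) ≤_) (sym frac-1) (proj₂ (ladder⊆[0,1] K (suc m))))
                                       (ℚP.≤-reflexive frac-1)
  ... | zero , inj₂ refl = bottom-covered (ℚP.≤-reflexive (sym frac-0))
                                          (subst (_≤ ladder K 1) (sym frac-0) (proj₁ (ladder⊆[0,1] K 1)))
  ... | suc k' , inj₁ refl = low-covered k'
  ... | suc k' , inj₂ refl = high-covered k'

  neg-lower : ∀ {j} → j ≤ₙ m → neg (lower j) ≡ upper (m ∸ j)
  neg-lower {zero} _ = sym upper-m
  neg-lower {suc j} sj≤m = begin
    neg (ladder K (suc (suc j)))           ≡⟨ neg-ladder 1≤K (rung-bound sj≤m) ⟩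
    ladder K ((K + K) ∸ suc (suc j))       ≡⟨ cong (λ z → ladder K (z ∸ suc j)) (ℕP.+-suc N N) ⟩
    ladder K (suc m ∸ suc j)               ≡⟨ cong (ladder K) (ℕP.+-∸-assoc 1 sj≤m) ⟩
    ladder K (suc (m ∸ suc j))             ≡⟨ sym (upper-inner (ℕP.<⇒≢ (ℕP.∸-monoʳ-< (s≤s z≤n) sj≤m))) ⟩
    upper (m ∸ suc j)                      ∎
    where open ≡-Reasoning

  partition : BlockPartition NM∞ (NM (suc m)) m
  partition = record
    { lower = lower ; upper = upper ; label = point
    ; lower≤upper = λ {j} _ → ℚP.≤-trans (lower≤rung j) (rung≤upper j)
    ; upper<lower = λ {j} j<m → subst (_< lower (suc j)) (sym (upper-inner (ℕP.<⇒≢ j<m)))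
                                      (ladder-step 1≤K (suc j) (rung-bound j<m))
    ; lower∈A = λ { {zero} _ → ladder∈NM∞ K 0 ; {suc j} _ → ladder∈NM∞ K (suc (suc j)) }
    ; lower-0 = refl
    ; neg-lower = neg-lower
    ; inner-singleton = λ { {suc j} _ j<m → sym (upper-inner (ℕP.<⇒≢ j<m)) }
    ; covers = covers
    ; A-neg = λ {a} → NM∞-neg {a}
    ; label-< = λ i<j _ → point-< i<j
    ; label∈B = point∈NM
    ; label-m = point-top
    ; neg-label = neg-point
    ; B-neg = λ {u} → NM-neg {u}
    ; B≤1 = λ {u} → NM≤1 {u}
    }

  open BlockReduction partition public using (reduction; _↦_; ↦-label)

  ↦1⇒high≤ : ∀ {a} → a ↦ 1ℚ → high K ≤ a
  ↦1⇒high≤ {a} a↦1 with ↦-label (subst (a ↦_) (sym point-top) a↦1) ℕP.≤-refl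
  ... | _ , lm≤a , _ = subst (_≤ a) top-rung lm≤a

NM∞-above-highs : ∀ {v} → NM∞ v → (∀ k → high (suc (suc k)) ≤ v) → v ≡ 1ℚ
NM∞-above-highs {v} v∈ above with NM∞-cases {v} v∈
... | zero , inj₁ refl = frac-1
... | suc k , inj₁ refl = ⊥-elim (ℚP.<-irrefl refl (ℚP.≤-<-trans high2≤high1 (high-< (ℕP.n<1+n 1))))
  where
  high2≤high1 : high 2 ≤ high 1
  high2≤high1 = ℚP.≤-trans (above 0) (low-≤ (s≤s z≤n))
... | k , inj₂ refl = ⊥-elim (ℚP.<-irrefl refl (ℚP.<-≤-trans (high-< (ℕP.m<n+m k (s≤s z≤n))) (above k)))

NM∞-taut⇒NM-taut : (L : Language) (φ : Formula L) → TAUT L NM∞ φ → ∀ (n : ℕ) → 2 ≤ₙ n → TAUT L (NM n) φ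
NM∞-taut⇒NM-taut L φ taut (suc (suc m')) _ M safe e v hv =
  Embedding.↦1⇒≡1 m' (Transfer.taut-↦1 (Embedding.reduction m') L M safe taut e hv)
NM∞-taut⇒NM-taut L φ taut (suc zero) (s≤s ())

NM-taut⇒NM∞-taut : (L : Language) (φ : Formula L) → (∀ (n : ℕ) → 2 ≤ₙ n → TAUT L (NM n) φ) → TAUT L NM∞ φ
NM-taut⇒NM∞-taut L φ taut M safe e v hv =
  NM∞-above-highs (NMReduction.↦-dom (Collapse.reduction 0) (v↦1 0)) (λ k → Collapse.↦1⇒high≤ k (v↦1 k))
  where
  v↦1 : ∀ k → Collapse._↦_ k v 1ℚ
  v↦1 k = Transfer.taut-↦1 (Collapse.reduction k) L M safe (taut _ (s≤s (s≤s z≤n))) e hv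

mainTheorem6 : (L : Language) (φ : Formula L)
    → (TAUT L NM∞ φ → (∀ (n : ℕ) → 2 ≤ₙ n → TAUT L (NM n) φ))
    × ((∀ (n : ℕ) → 2 ≤ₙ n → TAUT L (NM n) φ) → TAUT L NM∞ φ)
mainTheorem6 L φ = NM∞-taut⇒NM-taut L φ , NM-taut⇒NM∞-taut L φ
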